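{- Interpret the sequent rules of G4ip (listed in the context) as relations between exponential polynomials, taking the value of a rule's premise to be the product of the values of its premises (the empty product $1$ if there are none). If the variables $F,G,H,I,P$ are interpreted as natural numbers strictly greater than $1$ (and $\Gamma$ as a natural number $\ge 1$), then for every rule of G4ip the value of the premise is less than or equal to the value of the conclusion; moreover the inequality is strict if and only if the rule is non-invertible. Explicitly (premise vs. conclusion): invertible rules (equality): $(\to_r)$: $G^{F\Gamma}$ vs $(G^F)^\Gamma$; $(\wedge_r)$: $F^\Gamma G^\Gamma$ vs $(FG)^\Gamma$; $(\vee_l)$: $H^{F\Gamma}H^{G\Gamma}$ vs $H^{(F+G)\Gamma}$; $(\wedge_l)$: $H^{FG\Gamma}$ vs $H^{FG\Gamma}$; $(\to_l^\wedge)$: $I^{(H^G)^F\Gamma}$ vs $I^{H^{GF}\Gamma}$; $(\to_l^\vee)$: $I^{H^FH^G\Gamma}$ vs $I^{H^{F+G}\Gamma}$; non-invertible rules (strict inequality): (axiom): $1$ vs $P^{P\Gamma}$; $(\vee_r^1)$: $F^\Gamma$ vs $(F+G)^\Gamma$; $(\vee_r^2)$: $G^\Gamma$ vs $(F+G)^\Gamma$; $(\to_l^P)$: $G^{FP\Gamma}$ vs $G^{F^PP\Gamma}$; $(\to_l^\to)$: $(G^F)^{H^G\Gamma}I^{H\Gamma}$ vs $I^{H^{G^F}\Gamma}$.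
   Context: G4ip is the following sequent calculus for intuitionistic (minimal) propositional logic ($P$ atomic, $\Gamma$ a multiset of formulas): axiom $P,\Gamma\Rightarrow P$; $(\to_r)$ from $F,\Gamma\Rightarrow G$ infer $\Gamma\Rightarrow F\to G$; $(\wedge_r)$ from $\Gamma\Rightarrow F$ and $\Gamma\Rightarrow G$ infer $\Gamma\Rightarrow F\wedge G$; $(\vee_l)$ from $F,\Gamma\Rightarrow H$ and $G,\Gamma\Rightarrow H$ infer $F\vee G,\Gamma\Rightarrow H$; $(\wedge_l)$ from $F,G,\Gamma\Rightarrow H$ infer $F\wedge G,\Gamma\Rightarrow H$; $(\to_l^\wedge)$ from $F\to G\to H,\Gamma\Rightarrow I$ infer $G\wedge F\to H,\Gamma\Rightarrow I$; $(\to_l^\vee)$ from $F\to H,G\to H,\Gamma\Rightarrow I$ infer $F\vee G\to H,\Gamma\Rightarrow I$; $(\vee_r^1)$/$(\vee_r^2)$ from $\Gamma\Rightarrow F$ (resp. $\Gamma\Rightarrow G$) infer $\Gamma\Rightarrow F\vee G$; $(\to_l^P)$ from $F,P,\Gamma\Rightarrow G$ infer $P\to F,P,\Gamma\Rightarrow G$; $(\to_l^\to)$ from $G\to H,\Gamma\Rightarrow F\to G$ and $H,\Gamma\Rightarrow I$ infer $(F\to G)\to H,\Gamma\Rightarrow I$. The rules $(\to_r),(\wedge_r),(\vee_l),(\wedge_l),(\to_l^\wedge),(\to_l^\vee)$ are called invertible, the others non-invertible. A sequent $\Gamma\Rightarrow F$ is read as the exponential polynomial $F^{\Gamma}$, where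 a context is read as the product of its formulas, $F\wedge G$ as $FG$, $F\vee G$ as $F+G$, and $F\to G$ as $G^F$; the displayed expressions in the claim are the resulting readings of premises and conclusions. -}

module Defs where

open import Data.Nat using (ℕ; _+_; _*_; _^_)
open import Data.Bool using (Bool; true; false)

data Rule : Set where
  ax →r ∧r ∨l ∧l →l∧ →l∨ ∨r1 ∨r2 →lP →l→ : Rule

invertible : Rule → Bool
invertible →r  = true
invertible ∧r  = true
invertible ∨l  = true
invertible ∧l  = true
invertible →l∧ = true
invertible →l∨ = true
invertible ax  = false
invertible ∨r1 = false
invertible ∨r2 = false
invertible →lP = false
invertible →l→ = false

-- Value of the premise (product of the readings of the premises, 1 if none),
-- for given values of F G H I P Γ.  Note: x ^ y is x to the power y,
-- so the formula F → G is read as G ^ F.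
premise : Rule → (F G H I P Γ : ℕ) → ℕ
premise ax  F G H I P Γ = 1
premise →r  F G H I P Γ = G ^ (F * Γ)
premise ∧r  F G H I P Γ = (F ^ Γ) * (G ^ Γ)
premise ∨l  F G H I P Γ = (H ^ (F * Γ)) * (H ^ (G * Γ))
premise ∧l  F G H I P Γ = H ^ (F * G * Γ)
premise →l∧ F G H I P Γ = I ^ (((H ^ G) ^ F) * Γ)
premise →l∨ F G H I P Γ = I ^ ((H ^ F) * (H ^ G) * Γ)
premise ∨r1 F G H I P Γ = F ^ Γ
premise ∨r2 F G H I P Γ = G ^ Γ
premise →lP F G H I P Γ = G ^ (F * P * Γ)
premise →l→ F G H I P Γ = ((G ^ F) ^ ((H ^ G) * Γ)) * (I ^ (H * Γ))

conclusion : Rule → (F G H I P Γ : ℕ) → ℕ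
conclusion ax  F G H I P Γ = P ^ (P * Γ)
conclusion →r  F G H I P Γ = (G ^ F) ^ Γ
conclusion ∧r  F G H I P Γ = (F * G) ^ Γ
conclusion ∨l  F G H I P Γ = H ^ ((F + G) * Γ)
conclusion ∧l  F G H I P Γ = H ^ (F * G * Γ)
conclusion →l∧ F G H I P Γ = I ^ ((H ^ (G * F)) * Γ)
conclusion →l∨ F G H I P Γ = I ^ ((H ^ (F + G)) * Γ)
conclusion ∨r1 F G H I P Γ = (F + G) ^ Γ
conclusion ∨r2 F G H I P Γ = (F + G) ^ Γ
conclusion →lP F G H I P Γ = G ^ ((F ^ P) * P * Γ)
conclusion →l→ F G H I P Γ = I ^ ((H ^ (G ^ F)) * Γ)

module Submission where

-- Equalities are the exponent laws (a ^ m) ^ n = a ^ (m * n),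
-- a ^ (m + n) = a ^ m * a ^ n and (a * b) ^ n = a ^ n * b ^ n.
-- The strict inequalities come from strict monotonicity of powers, plus two
-- growth facts for a base a > 1:  n < a ^ n  and  a * n ≤ a ^ n (n ≥ 1).
-- The one substantial case is (→l→):  G ^ (F H^G Γ) · I ^ (H Γ) < I ^ (H^(G^F) Γ).
-- Bounding G ≤ I ^ (G - 1) reduces it to the exponent inequality
--   (G - 1) F H^G + H < H ^ (G ^ F),
-- which follows from  (G - 1) F + 1 ≤ H ^ (G (F - 1))  and  G F ≤ G ^ F.

open import Defs
open import Data.Bool using (true; false)
open import Data.Empty using (⊥-elim)
open import Data.Product using (_×_; _,_)
open import Function.Bundles using (_⇔_; mk⇔)
open import Data.Nat
open import Data.Nat.Properties
open import Data.Nat.Solver using (module +-*-Solver)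
open +-*-Solver using (solve; _:+_; _:*_; _:=_; con)
open import Relation.Binary.PropositionalEquality

^-distribʳ-* : ∀ a b n → (a * b) ^ n ≡ a ^ n * b ^ n
^-distribʳ-* a b zero = refl
^-distribʳ-* a b (suc n) rewrite ^-distribʳ-* a b n =
  solve 4 (λ a b x y → a :* b :* (x :* y) := a :* x :* (b :* y)) refl a b (a ^ n) (b ^ n)

n<a^n : ∀ {a} → 1 < a → ∀ n → n < a ^ n
n<a^n 1<a zero = ≤-refl
n<a^n {a@(suc (suc _))} 1<a (suc n) = begin-strict
  suc n          ≤⟨ n<a^n 1<a n ⟩
  a ^ n          <⟨ m<m+n (a ^ n) (m^n>0 a n) ⟩
  a ^ n + a ^ n  ≡⟨ cong (a ^ n +_) (sym (+-identityʳ (a ^ n))) ⟩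
  2 * a ^ n      ≤⟨ *-monoˡ-≤ (a ^ n) 1<a ⟩
  a * a ^ n      ∎
  where open ≤-Reasoning
n<a^n {suc zero} (s≤s ()) (suc n)

a*m≤a^m : ∀ {a} → 1 < a → ∀ n → a * suc n ≤ a ^ suc n
a*m≤a^m {a} 1<a n = *-monoʳ-≤ a (n<a^n 1<a n)

counting-bound : ∀ g f {H} → 1 < H → g * (2 + f) + 1 ≤ H ^ (suc g * suc f)
counting-bound g f {H} 1<H = begin
  g * (2 + f) + 1          ≤⟨ +-monoʳ-≤ (g * (2 + f)) (s≤s z≤n) ⟩
  g * (2 + f) + (2 + f)    ≡⟨ +-comm (g * (2 + f)) (2 + f) ⟩
  suc g * (1 + suc f)      ≤⟨ *-monoʳ-≤ (suc g) (+-monoˡ-≤ (suc f) (s≤s z≤n)) ⟩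
  suc g * (suc f + suc f)  ≡⟨ solve 2 (λ g f → g :* (f :+ f) := con 2 :* (g :* f)) refl (suc g) (suc f) ⟩
  2 * (suc g * suc f)      ≤⟨ a*m≤a^m {2} ≤-refl (f + g * suc f) ⟩
  2 ^ (suc g * suc f)      ≤⟨ ^-monoˡ-≤ (suc g * suc f) 1<H ⟩
  H ^ (suc g * suc f)      ∎
  where open ≤-Reasoning

exponent-bound : ∀ g f {H} → 1 ≤ g → 1 < H →
  g * (2 + f) * H ^ suc g + H < H ^ (suc g ^ (2 + f))
exponent-bound g f {H} 1≤g 1<H = begin-strict
  g * F * c + H          <⟨ +-monoʳ-< (g * F * c) H<c ⟩
  g * F * c + c          ≡⟨ solve 2 (λ x c → x :* c :+ c := c :* (x :+ con 1)) refl (g * F) c ⟩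
  c * (g * F + 1)        ≤⟨ *-monoʳ-≤ c (counting-bound g f 1<H) ⟩
  c * H ^ (G * suc f)    ≡⟨ sym (^-distribˡ-+-* H G (G * suc f)) ⟩
  H ^ (G + G * suc f)    ≡⟨ cong (H ^_) (sym (*-suc G (suc f))) ⟩
  H ^ (G * F)            ≤⟨ ^-monoʳ-≤ H (a*m≤a^m (s≤s 1≤g) (suc f)) ⟩
  H ^ (G ^ F)            ∎
  where
    open ≤-Reasoning
    G = suc g
    F = 2 + f
    c = H ^ G
    instance
      H≢0 : NonZero H
      H≢0 = >-nonZero (<-trans z<s 1<H)
    H<c : H < c
    H<c = subst (_< c) (*-identityʳ H) (^-monoʳ-< H 1<H (s≤s 1≤g))

→l→-strict : ∀ F G H I Γ → 1 < F → 1 < G → 1 < H → 1 < I → 1 ≤ Γ →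
  (G ^ F) ^ (H ^ G * Γ) * I ^ (H * Γ) < I ^ (H ^ (G ^ F) * Γ)
→l→-strict F@(suc (suc f)) G@(suc g) H I Γ@(suc _) _ (s≤s 1≤g) 1<H 1<I _ = begin-strict
  (G ^ F) ^ (c * Γ) * I ^ (H * Γ)  ≡⟨ cong (_* I ^ (H * Γ)) (^-*-assoc G F (c * Γ)) ⟩
  G ^ e * I ^ (H * Γ)              ≤⟨ *-monoˡ-≤ (I ^ (H * Γ)) G^e≤ ⟩
  I ^ (g * e) * I ^ (H * Γ)        ≡⟨ sym (^-distribˡ-+-* I (g * e) (H * Γ)) ⟩
  I ^ (g * e + H * Γ)              ≡⟨ cong (I ^_) (solve 5 (λ g F c Γ H →
                                        g :* (F :* (c :* Γ)) :+ H :* Γ := (g :* F :* c :+ H) :* Γ)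
                                        refl g F c Γ H) ⟩
  I ^ ((g * F * c + H) * Γ)        <⟨ ^-monoʳ-< I 1<I (*-monoˡ-< Γ (exponent-bound g f 1≤g 1<H)) ⟩
  I ^ (H ^ (G ^ F) * Γ)            ∎
  where
    open ≤-Reasoning
    c = H ^ G
    e = F * (c * Γ)
    -- G ≤ I ^ g, raised to the power e.
    G^e≤ : G ^ e ≤ I ^ (g * e)
    G^e≤ = ≤-trans (^-monoˡ-≤ e (n<a^n 1<I g)) (≤-reflexive (^-*-assoc I g e))
→l→-strict (suc zero) _ _ _ _ (s≤s ()) _ _ _ _

invertible⇒equal : ∀ r F G H I P Γ → invertible r ≡ true →
  premise r F G H I P Γ ≡ conclusion r F G H I P Γ
invertible⇒equal →r  F G H I P Γ _ = sym (^-*-assoc G F Γ)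
invertible⇒equal ∧r  F G H I P Γ _ = sym (^-distribʳ-* F G Γ)
invertible⇒equal ∨l  F G H I P Γ _ = begin
  H ^ (F * Γ) * H ^ (G * Γ)  ≡⟨ sym (^-distribˡ-+-* H (F * Γ) (G * Γ)) ⟩
  H ^ (F * Γ + G * Γ)        ≡⟨ cong (H ^_) (sym (*-distribʳ-+ Γ F G)) ⟩
  H ^ ((F + G) * Γ)          ∎
  where open ≡-Reasoning
invertible⇒equal ∧l  F G H I P Γ _ = refl
invertible⇒equal →l∧ F G H I P Γ _ = cong (λ x → I ^ (x * Γ)) (^-*-assoc H G F)
invertible⇒equal →l∨ F G H I P Γ _ = cong (λ x → I ^ (x * Γ)) (sym (^-distribˡ-+-* H F G))
invertible⇒equal ax  F G H I P Γ ()
invertible⇒equal ∨r1 F G H I P Γ ()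
invertible⇒equal ∨r2 F G H I P Γ ()
invertible⇒equal →lP F G H I P Γ ()
invertible⇒equal →l→ F G H I P Γ ()

noninvertible⇒strict : ∀ r F G H I P Γ → invertible r ≡ false →
  1 < F → 1 < G → 1 < H → 1 < I → 1 < P → 1 ≤ Γ →
  premise r F G H I P Γ < conclusion r F G H I P Γ
noninvertible⇒strict ax  F G H I P Γ _ _ _ _ _ 1<P 1≤Γ =
  ^-monoʳ-< P 1<P (*-mono-≤ (<⇒≤ 1<P) 1≤Γ)
noninvertible⇒strict ∨r1 F G H I P Γ@(suc _) _ _ 1<G _ _ _ _ =
  ^-monoˡ-< Γ (m<m+n F (<⇒≤ 1<G))
noninvertible⇒strict ∨r2 F G H I P Γ@(suc _) _ 1<F _ _ _ _ _ =
  ^-monoˡ-< Γ (m<n+m G (<⇒≤ 1<F))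
noninvertible⇒strict →lP F G H I P@(suc _) Γ@(suc _) _ 1<F 1<G _ _ 1<P _ =
  ^-monoʳ-< G 1<G (*-monoˡ-< Γ (*-monoˡ-< P F<F^P))
  where
    F<F^P : F < F ^ P
    F<F^P = subst (_< F ^ P) (*-identityʳ F) (^-monoʳ-< F 1<F 1<P)
noninvertible⇒strict →l→ F G H I P Γ _ 1<F 1<G 1<H 1<I _ 1≤Γ =
  →l→-strict F G H I Γ 1<F 1<G 1<H 1<I 1≤Γ
noninvertible⇒strict →r  F G H I P Γ ()
noninvertible⇒strict ∧r  F G H I P Γ ()
noninvertible⇒strict ∨l  F G H I P Γ ()
noninvertible⇒strict ∧l  F G H I P Γ ()
noninvertible⇒strict →l∧ F G H I P Γ ()
noninvertible⇒strict →l∨ F G H I P Γ ()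

theorem6 : (r : Rule) (F G H I P Γ : ℕ) →
    1 < F → 1 < G → 1 < H → 1 < I → 1 < P → 1 ≤ Γ →
    premise r F G H I P Γ ≤ conclusion r F G H I P Γ
    × ((premise r F G H I P Γ < conclusion r F G H I P Γ) ⇔ (invertible r ≡ false))
theorem6 r F G H I P Γ 1<F 1<G 1<H 1<I 1<P 1≤Γ with invertible r in inv
... | true  = ≤-reflexive same , mk⇔ (λ lt → ⊥-elim (<-irrefl same lt)) (λ ())
  where
    same : premise r F G H I P Γ ≡ conclusion r F G H I P Γ
    same = invertible⇒equal r F G H I P Γ inv
... | false = <⇒≤ grows , mk⇔ (λ _ → refl) (λ _ → grows)
  where
    grows : premise r F G H I P Γ < conclusion r F G H I P Γ
    grows = noninvertible⇒strict r F G H I P Γ inv 1<F 1<G 1<H 1<I 1<P 1≤Γ
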